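{- Let $u,v,w$ be independent indeterminates over $\mathbb{Q}$, and for an element $X$ of a field of characteristic $0$ put $t_X = \frac{X(X+1)}{2}$. There exist rational functions $x,y,z,p,q,r \in \mathbb{Q}(u,v,w)$ such that \[ t_x + t_y = t_p,\qquad t_y + t_z = t_q,\qquad t_z + t_x = t_r \] hold identically in $\mathbb{Q}(u,v,w)$, and this solution genuinely depends on three parameters, i.e. the Jacobian matrix of $(x,y,z,p,q,r)$ with respect to $(u,v,w)$ has rank $3$ over $\mathbb{Q}(u,v,w)$.
   Context: $t_X = X(X+1)/2$ is the triangular-number polynomial, extended to rational arguments and rational functions. A "three-parameter rational solution" of the system means a solution by rational functions in three independent parameters that does not reduce to fewer parameters (formalized by the Jacobian rank condition). -}

module Defs where

open import Data.Nat using (ℕ; zero; suc)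
open import Data.Fin using (Fin; zero; suc)
open import Data.Integer using (+_)
open import Data.List using (List; []; _∷_; map)
open import Data.List.Relation.Unary.All using (All)
open import Data.Product using (_×_; _,_; proj₁; proj₂)
open import Relation.Nullary using (¬_)
open import Relation.Binary.PropositionalEquality using (_≡_)
open import Data.Rational as ℚ using (ℚ; 0ℚ; 1ℚ; ½)

-- Polynomials in n variables over ℚ (dense recursive representation):
-- Poly (suc n) = polynomials in the outermost variable with
-- coefficients in Poly n, as coefficient lists c₀ ∷ c₁ ∷ … (c₀ + c₁X + …).

Poly : ℕ → Set
Poly zero    = ℚ
Poly (suc n) = List (Poly n)

IsZero : ∀ {n} → Poly n → Set
IsZero {zero}  c = c ≡ 0ℚ
IsZero {suc n} p = All (IsZero {n}) p

zeroP : ∀ {n} → Poly n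
zeroP {zero}  = 0ℚ
zeroP {suc n} = []

constP : ∀ {n} → ℚ → Poly n
constP {zero}  c = c
constP {suc n} c = constP c ∷ []

addP : ∀ {n} → Poly n → Poly n → Poly n
addP {zero}  a b = a ℚ.+ b
addP {suc n} [] q = q
addP {suc n} (a ∷ p) [] = a ∷ p
addP {suc n} (a ∷ p) (b ∷ q) = addP a b ∷ addP p q

scaleP : ∀ {n} → ℚ → Poly n → Poly n
scaleP {zero}  k a = k ℚ.* a
scaleP {suc n} k p = map (scaleP k) p

negP : ∀ {n} → Poly n → Poly n
negP = scaleP (ℚ.- 1ℚ)

mulP : ∀ {n} → Poly n → Poly n → Poly n
mulP {zero}  a b = a ℚ.* b
mulP {suc n} [] q = []
mulP {suc n} (a ∷ p) q = addP (map (mulP a) q) (zeroP ∷ mulP p q)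

-- the variables X₀ (outermost), X₁, …
varP : ∀ {n} → Fin n → Poly n
varP {suc n} zero    = zeroP ∷ constP 1ℚ ∷ []
varP {suc n} (suc i) = varP i ∷ []

private
  dOuter : ∀ {n} → ℕ → List (Poly n) → List (Poly n)
  dOuter k [] = []
  dOuter k (b ∷ p) = scaleP ((+ k) ℚ./ 1) b ∷ dOuter (suc k) p

derivP : ∀ {n} → Fin n → Poly n → Poly n
derivP {suc n} zero    []      = []
derivP {suc n} zero    (a ∷ p) = dOuter 1 p
derivP {suc n} (suc i) p       = map (derivP i) p

-- Fractions num/den; they represent elements of ℚ(X₀,…,X_{n-1}) when the
-- denominator is a nonzero polynomial (WellFormed).

Frac : ℕ → Set
Frac n = Poly n × Poly n

num den : ∀ {n} → Frac n → Poly n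
num = proj₁
den = proj₂

WellFormed : ∀ {n} → Frac n → Set
WellFormed f = ¬ IsZero (den f)

_≈F_ : ∀ {n} → Frac n → Frac n → Set
f ≈F g = IsZero (addP (mulP (num f) (den g)) (negP (mulP (num g) (den f))))

NonZeroF : ∀ {n} → Frac n → Set
NonZeroF f = ¬ IsZero (num f)

fromPoly : ∀ {n} → Poly n → Frac n
fromPoly p = p , constP 1ℚ

varF : ∀ {n} → Fin n → Frac n
varF i = fromPoly (varP i)

constF : ∀ {n} → ℚ → Frac n
constF c = fromPoly (constP c)

_+F_ : ∀ {n} → Frac n → Frac n → Frac n
f +F g = addP (mulP (num f) (den g)) (mulP (num g) (den f)) , mulP (den f) (den g)

_*F_ : ∀ {n} → Frac n → Frac n → Frac n
f *F g = mulP (num f) (num g) , mulP (den f) (den g)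

-F_ : ∀ {n} → Frac n → Frac n
-F f = negP (num f) , den f

derivF : ∀ {n} → Fin n → Frac n → Frac n
derivF i f =
  addP (mulP (derivP i (num f)) (den f)) (negP (mulP (num f) (derivP i (den f))))
  , mulP (den f) (den f)

tri : ∀ {n} → Frac n → Frac n
tri X = constF ½ *F (X *F (X +F constF 1ℚ))

-- 3×3 determinant and Jacobian rank 3 (determinantal rank: some 3×3 minor
-- of the 6×3 Jacobian is a nonzero element of the fraction field).

det3 : ∀ {n} → (Fin 3 → Fin 3 → Frac n) → Frac n
det3 M =
      (a₀₀ *F ((a₁₁ *F a₂₂) +F (-F (a₁₂ *F a₂₁))))
   +F ((-F (a₀₁ *F ((a₁₀ *F a₂₂) +F (-F (a₁₂ *F a₂₀)))))
   +F (a₀₂ *F ((a₁₀ *F a₂₁) +F (-F (a₁₁ *F a₂₀)))))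
  where
  a₀₀ = M zero zero
  a₀₁ = M zero (suc zero)
  a₀₂ = M zero (suc (suc zero))
  a₁₀ = M (suc zero) zero
  a₁₁ = M (suc zero) (suc zero)
  a₁₂ = M (suc zero) (suc (suc zero))
  a₂₀ = M (suc (suc zero)) zero
  a₂₁ = M (suc (suc zero)) (suc zero)
  a₂₂ = M (suc (suc zero)) (suc (suc zero))

jacobian : ∀ {m n} → (Fin m → Frac n) → Fin m → Fin n → Frac n
jacobian F i j = derivF j (F i)

HasRank3 : ∀ {m n} → (Fin m → Fin 3 → Frac n) → Set
HasRank3 {m} J = Data.Product.∃ λ (r : Fin 3 → Fin m) → NonZeroF (det3 (λ i j → J (r i) j))

six : ∀ {A : Set} → A → A → A → A → A → A → Fin 6 → A
six x y z p q r zero = x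
six x y z p q r (suc zero) = y
six x y z p q r (suc (suc zero)) = z
six x y z p q r (suc (suc (suc zero))) = p
six x y z p q r (suc (suc (suc (suc zero)))) = q
six x y z p q r (suc (suc (suc (suc (suc zero))))) = r

{-# OPTIONS --safe #-}
-- Substituting p = x + u y turns t_x + t_y = t_p into
-- u y (2x + u y + 1) = y (y + 1), i.e. (after cancelling y) into the equation
-- 2u x + (u² − 1) y = 1 − u, which is LINEAR in x and y.  Likewise
-- q = z + v y and r = x + w z give 2v z + (v² − 1) y = 1 − v and
-- 2w x + (w² − 1) z = 1 − w.  Cramer's rule solves this 3×3 system over
-- ℚ(u,v,w); its determinant 2u(v² − 1)(w² − 1) + 4vw(u² − 1) is nonzero.
-- The three identities and the nonvanishing of the Jacobian minor of rows
-- x, y, z are then finite polynomial computations, decided by normalisation.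
module Submission where

open import Defs
open import Data.Fin using (Fin; _↑ˡ_; _≟_)
open import Data.Fin.Patterns using (0F; 1F; 2F)
open import Data.List.Relation.Unary.All using (all?)
open import Data.Nat using (zero; suc)
open import Data.Product using (Σ; _×_; _,_)
open import Data.Rational as ℚ using (0ℚ; 1ℚ)
open import Data.Unit using (tt)
open import Relation.Nullary using (Dec; yes; no; ¬_)
open import Relation.Nullary.Decidable using (True; False; toWitness; toWitnessFalse)

isZero? : ∀ {n} (f : Poly n) → Dec (IsZero f)
isZero? {zero}  c = c ℚ.≟ 0ℚ
isZero? {suc n} f = all? isZero? f

infixl 6 _+ₚ_ _-ₚ_
infixl 7 _*ₚ_

_+ₚ_ _-ₚ_ _*ₚ_ : ∀ {n} → Poly n → Poly n → Poly n
f +ₚ g = addP f g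
f -ₚ g = addP f (negP g)
f *ₚ g = mulP f g

det3ₚ : ∀ {n} → (Fin 3 → Fin 3 → Poly n) → Poly n
det3ₚ M = M 0F 0F *ₚ minor 1F 2F -ₚ M 0F 1F *ₚ minor 0F 2F +ₚ M 0F 2F *ₚ minor 0F 1F
  where
  minor : Fin 3 → Fin 3 → Poly _
  minor j j′ = M 1F j *ₚ M 2F j′ -ₚ M 1F j′ *ₚ M 2F j

replaceColumn : ∀ {A : Set} → Fin 3 → (Fin 3 → A) → (Fin 3 → Fin 3 → A) → Fin 3 → Fin 3 → A
replaceColumn k b M i j with j ≟ k
... | yes _ = b i
... | no  _ = M i j

-- Cramer's rule: the k-th unknown of M ξ = b is cramerNumerator M b k / det3ₚ M.
cramerNumerator : ∀ {n} → (Fin 3 → Fin 3 → Poly n) → (Fin 3 → Poly n) → Fin 3 → Poly n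
cramerNumerator M b k = det3ₚ (replaceColumn k b M)

u v w one : Poly 3
u   = varP 0F
v   = varP 1F
w   = varP 2F
one = constP 1ℚ

-- The equation s (2a + s b + 1) = b + 1 making t_a + t_b = t_(a + s b)
-- reads (2s) a + shearCoefficient s · b = shearConstant s.
shearCoefficient shearConstant : Poly 3 → Poly 3
shearCoefficient s = s *ₚ s -ₚ one
shearConstant    s = one -ₚ s

-- Unknowns ordered (x, y, z).  Zero entries are zeroP, not constP 0ℚ: the
-- latter pads every product with zero coefficients and makes the
-- normalisation checks below several times slower.
system : Fin 3 → Fin 3 → Poly 3
system 0F 0F = u +ₚ u
system 0F 1F = shearCoefficient u
system 0F 2F = zeroP
system 1F 0F = zeroP
system 1F 1F = shearCoefficient v
system 1F 2F = v +ₚ v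
system 2F 0F = w +ₚ w
system 2F 1F = zeroP
system 2F 2F = shearCoefficient w

constants : Fin 3 → Poly 3
constants 0F = shearConstant u
constants 1F = shearConstant v
constants 2F = shearConstant w

Δ X Y Z : Poly 3
Δ = det3ₚ system
X = cramerNumerator system constants 0F
Y = cramerNumerator system constants 1F
Z = cramerNumerator system constants 2F

x y z p q r : Frac 3
x = X , Δ
y = Y , Δ
z = Z , Δ
p = X +ₚ u *ₚ Y , Δ
q = Z +ₚ v *ₚ Y , Δ
r = X +ₚ w *ₚ Z , Δ

theorem2 : Σ (Frac 3) λ x → Σ (Frac 3) λ y → Σ (Frac 3) λ z →
    Σ (Frac 3) λ p → Σ (Frac 3) λ q → Σ (Frac 3) λ r →
    (WellFormed x × WellFormed y × WellFormed z ×
    WellFormed p × WellFormed q × WellFormed r)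
    × ((tri x +F tri y) ≈F tri p)
    × ((tri y +F tri z) ≈F tri q)
    × ((tri z +F tri x) ≈F tri r)
    × HasRank3 (jacobian (six x y z p q r))
theorem2 =
  x , y , z , p , q , r
  , (Δ≢0 , Δ≢0 , Δ≢0 , Δ≢0 , Δ≢0 , Δ≢0)
  , byNormalisation tt , byNormalisation tt , byNormalisation tt
  , (_↑ˡ 3) , nonzeroByNormalisation tt
  where
  byNormalisation : ∀ {n} {f : Poly n} → True (isZero? f) → IsZero f
  byNormalisation = toWitness

  nonzeroByNormalisation : ∀ {n} {f : Poly n} → False (isZero? f) → ¬ IsZero f
  nonzeroByNormalisation = toWitnessFalse

  Δ≢0 : ¬ IsZero Δ
  Δ≢0 = nonzeroByNormalisation tt
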